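{- Let $\mathcal{E}$ be a set of equations over the terms $\mathcal{T}$ described in the context, with $\sim$ and $\to_\beta$ as defined there, and assume $\mathcal{E}$ is linear. If a term $t$ is strongly normalizing for $\to_\beta$ (there is no infinite sequence $t\to_\beta t_1\to_\beta t_2\to_\beta\cdots$), then $t$ is strongly normalizing for the relation $\sim\!\to_\beta$, where $a\ (\sim\!\to_\beta)\ b$ iff there exists $a'$ with $a\sim a'$ and $a'\to_\beta b$.
   Context: Terms (considered modulo renaming of bound variables): $t,u ::= s \mid x \mid f \mid [x:t]u \mid tu \mid (x:t)u$, where $s\in\{\star,\Box\}$ is a sort, $x$ ranges over an infinite set of variables, $f$ ranges over a set $\mathcal{F}$ of symbols, $[x:t]u$ is an abstraction (binding $x$ in $u$), $tu$ an application and $(x:t)u$ a dependent product (binding $x$ in $u$). Every symbol $f$ has an arity $\alpha_f\in\mathbb{N}$. A term is algebraic if it is built only from variables and applications $f t_1\ldots t_n$ with $n=\alpha_f$. $\mathrm{FV}(t)$ is the set of free variables of $t$; $t|_p$ is the subterm at position $p$ and $t[u]_p$ the replacement of $t|_p$ by $u$. For a set of pairs of terms $\mathcal{E}$, $t\to_{\mathcal{E}} t'$ iff there are a position $p$, a pair $l\to r\in\mathcal{E}$ and a substitution $\sigma$ with $t|_p=l\sigma$ and $t'=t[r\sigma]_p$. $t\to_\beta t'$ iff there is a position $p$ with $t|_p=([x:U]v)\,u$ and $t'=t[v\{x\mapsto u\}]_p$. A set of equations $\mathcal{E}$ is a symmetric set of pairs ($l\to r\in\mathcal{E}$ iff $r\to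 l\in\mathcal{E}$) such that for each $l\to r\in\mathcal{E}$ both $l$ and $r$ are algebraic, headed by a symbol, and $\mathrm{FV}(l)=\mathrm{FV}(r)$. $\mathcal{E}$ is linear if in every $l\to r\in\mathcal{E}$ no variable occurs more than once in $l$ and no variable occurs more than once in $r$. $\sim$ is the reflexive and transitive closure of $\to_{\mathcal{E}}$. -}

module Defs where

open import Data.Nat using (ℕ; zero; suc; _+_; _≤_)
open import Data.Nat.Properties using (_≟_)
open import Data.Vec using (Vec; []; _∷_)
open import Data.Vec.Relation.Unary.All using (All)
open import Data.Product using (Σ; ∃; _×_; _,_)
open import Data.Empty using (⊥)
open import Function.Bundles using (_⇔_)
open import Relation.Nullary using (¬_; yes; no)
open import Relation.Binary.PropositionalEquality using (_≡_)
open import Relation.Binary.Construct.Closure.ReflexiveTransitive using (Star)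

data Sort : Set where
  ⋆ □ : Sort

-- Terms over a set F of symbols, with variables as de Bruijn indices
-- (so terms are identified modulo renaming of bound variables).
--   lam t u  represents  [x:t]u   (binds x in u only)
--   pi  t u  represents  (x:t)u   (binds x in u only)
data Term (F : Set) : Set where
  sort : Sort → Term F
  var  : ℕ → Term F
  fun  : F → Term F
  lam  : Term F → Term F → Term F
  app  : Term F → Term F → Term F
  pi   : Term F → Term F → Term F

module _ {F : Set} where

  ext : (ℕ → ℕ) → ℕ → ℕ
  ext ρ zero = zero
  ext ρ (suc n) = suc (ρ n)

  rename : (ℕ → ℕ) → Term F → Term F
  rename ρ (sort s) = sort s
  rename ρ (var x) = var (ρ x)
  rename ρ (fun f) = fun f
  rename ρ (lam t u) = lam (rename ρ t) (rename (ext ρ) u)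
  rename ρ (app t u) = app (rename ρ t) (rename ρ u)
  rename ρ (pi t u) = pi (rename ρ t) (rename (ext ρ) u)

  exts : (ℕ → Term F) → ℕ → Term F
  exts σ zero = var zero
  exts σ (suc n) = rename suc (σ n)

  sub : (ℕ → Term F) → Term F → Term F
  sub σ (sort s) = sort s
  sub σ (var x) = σ x
  sub σ (fun f) = fun f
  sub σ (lam t u) = lam (sub σ t) (sub (exts σ) u)
  sub σ (app t u) = app (sub σ t) (sub σ u)
  sub σ (pi t u) = pi (sub σ t) (sub (exts σ) u)

  _[_] : Term F → Term F → Term F
  v [ u ] = sub σ v
    where
    σ : ℕ → Term F
    σ zero = u
    σ (suc n) = var n

  apps : Term F → {n : ℕ} → Vec (Term F) n → Term F
  apps h [] = h
  apps h (t ∷ ts) = apps (app h t) ts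

  data Algebraic (α : F → ℕ) : Term F → Set where
    alg-var : (x : ℕ) → Algebraic α (var x)
    alg-fun : (f : F) (ts : Vec (Term F) (α f)) → All (Algebraic α) ts →
              Algebraic α (apps (fun f) ts)

  HeadedBySymbol : Term F → Set
  HeadedBySymbol t = Σ F λ f → Σ ℕ λ n → Σ (Vec (Term F) n) λ ts → t ≡ apps (fun f) ts

  data _∈FV_ : ℕ → Term F → Set where
    fv-var  : (x : ℕ) → x ∈FV var x
    fv-lamˡ : ∀ {x t u} → x ∈FV t → x ∈FV lam t u
    fv-lamʳ : ∀ {x t u} → suc x ∈FV u → x ∈FV lam t u
    fv-appˡ : ∀ {x t u} → x ∈FV t → x ∈FV app t u
    fv-appʳ : ∀ {x t u} → x ∈FV u → x ∈FV app t u
    fv-piˡ  : ∀ {x t u} → x ∈FV t → x ∈FV pi t u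
    fv-piʳ  : ∀ {x t u} → suc x ∈FV u → x ∈FV pi t u

  occ : ℕ → Term F → ℕ
  occ x (sort s) = 0
  occ x (var y) with x ≟ y
  ... | yes _ = 1
  ... | no _ = 0
  occ x (fun f) = 0
  occ x (lam t u) = occ x t + occ (suc x) u
  occ x (app t u) = occ x t + occ x u
  occ x (pi t u) = occ x t + occ (suc x) u

  record IsEquations (α : F → ℕ) (E : Term F → Term F → Set) : Set where
    field
      symmetric : ∀ l r → E l r → E r l
      alg-l     : ∀ l r → E l r → Algebraic α l
      alg-r     : ∀ l r → E l r → Algebraic α r
      head-l    : ∀ l r → E l r → HeadedBySymbol l
      head-r    : ∀ l r → E l r → HeadedBySymbol r
      fv-eq     : ∀ l r → E l r → ∀ x → (x ∈FV l) ⇔ (x ∈FV r)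

  Linear : (Term F → Term F → Set) → Set
  Linear E = ∀ l r → E l r → ∀ x → (occ x l ≤ 1) × (occ x r ≤ 1)

  data Compat (R : Term F → Term F → Set) : Term F → Term F → Set where
    root  : ∀ {t t'} → R t t' → Compat R t t'
    lamˡ  : ∀ {t t' u} → Compat R t t' → Compat R (lam t u) (lam t' u)
    lamʳ  : ∀ {t u u'} → Compat R u u' → Compat R (lam t u) (lam t u')
    appˡ  : ∀ {t t' u} → Compat R t t' → Compat R (app t u) (app t' u)
    appʳ  : ∀ {t u u'} → Compat R u u' → Compat R (app t u) (app t u')
    piˡ   : ∀ {t t' u} → Compat R t t' → Compat R (pi t u) (pi t' u)
    piʳ   : ∀ {t u u'} → Compat R u u' → Compat R (pi t u) (pi t u')

  data ERoot (E : Term F → Term F → Set) : Term F → Term F → Set where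
    inst : ∀ {l r} → E l r → (σ : ℕ → Term F) → ERoot E (sub σ l) (sub σ r)

  _⟶E_ : (E : Term F → Term F → Set) → Term F → Term F → Set
  _⟶E_ E = Compat (ERoot E)

  _∼[_]_ : Term F → (Term F → Term F → Set) → Term F → Set
  t ∼[ E ] t' = Star (E ⟶E_) t t'

  data βRoot : Term F → Term F → Set where
    beta : ∀ U v u → βRoot (app (lam U v) u) (v [ u ])

  _⟶β_ : Term F → Term F → Set
  _⟶β_ = Compat βRoot

  _∼⟶β[_]_ : Term F → (Term F → Term F → Set) → Term F → Set
  a ∼⟶β[ E ] b = ∃ λ a' → (a ∼[ E ] a') × (a' ⟶β b)

  SN : (Term F → Term F → Set) → Term F → Set
  SN R t = ¬ (Σ (ℕ → Term F) λ s → (s 0 ≡ t) × (∀ n → R (s n) (s (suc n))))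

-- Every E-step can be pushed behind a β-step: if a ∼ a′ →β b then a →β b′ ∼ b for some b′.
-- Along an infinite (∼ →β)-sequence this lets all E-steps be postponed forever, leaving an
-- infinite β-sequence from the same term. The only interesting case is a β-step inside an
-- instance rσ of an equation l → r: as r is algebraic and headed by a symbol, the step happens
-- inside some σ x, and linearity of l and r lets it be replayed exactly once in lσ.
module Submission where

open import Defs
open import Data.Nat using (ℕ; zero; suc; _≤_; z≤n; s≤s)
open import Data.Nat.Properties using (_≟_; ≟-diag; ≤-trans; 1+n≰n; m≤m+n; m≤n+m; +-mono-≤)
open import Data.Vec using (Vec; []; _∷_)
open import Data.Vec.Relation.Unary.All using (All; []; _∷_)
open import Data.Product using (∃; _,_; proj₁; proj₂)
open import Data.Empty using (⊥-elim)
open import Function using (_∘_)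
open import Function.Bundles using (Equivalence)
open import Relation.Nullary using (¬_; yes; no)
open import Relation.Binary.Core using (_⇒_)
open import Relation.Binary.PropositionalEquality
  using (_≡_; _≢_; refl; sym; cong; cong₂; subst; subst₂; module ≡-Reasoning)
open import Relation.Binary.Construct.Closure.ReflexiveTransitive
  using (Star; ε; _◅_; _◅◅_; gmap; return)
open import Relation.Binary.Construct.Composition using (_;_)

module _ {F : Set} where

  private variable
    a a′ b b′ t u u′ v v′ c h : Term F
    x : ℕ
    ρ ρ′ ρ″ : ℕ → ℕ
    σ σ′ τ : ℕ → Term F
    Q R : Term F → Term F → Set
    P : ℕ → Set

  ext-fusion : (∀ x → ρ (ρ′ x) ≡ ρ″ x) →
               ∀ x → ext {F = F} ρ (ext {F = F} ρ′ x) ≡ ext {F = F} ρ″ x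
  ext-fusion eq zero    = refl
  ext-fusion eq (suc x) = cong suc (eq x)

  rename-fusion : (∀ x → ρ (ρ′ x) ≡ ρ″ x) →
                  (t : Term F) → rename ρ (rename ρ′ t) ≡ rename ρ″ t
  rename-fusion eq (sort s)  = refl
  rename-fusion eq (var x)   = cong var (eq x)
  rename-fusion eq (fun f)   = refl
  rename-fusion eq (lam t u) = cong₂ lam (rename-fusion eq t) (rename-fusion (ext-fusion eq) u)
  rename-fusion eq (app t u) = cong₂ app (rename-fusion eq t) (rename-fusion eq u)
  rename-fusion eq (pi t u)  = cong₂ pi (rename-fusion eq t) (rename-fusion (ext-fusion eq) u)

  exts-ext-fusion : (∀ x → τ (ρ x) ≡ σ x) → ∀ x → exts τ (ext {F = F} ρ x) ≡ exts σ x
  exts-ext-fusion eq zero    = refl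
  exts-ext-fusion eq (suc x) = cong (rename suc) (eq x)

  sub-rename-fusion : (∀ x → τ (ρ x) ≡ σ x) → (t : Term F) → sub τ (rename ρ t) ≡ sub σ t
  sub-rename-fusion eq (sort s)  = refl
  sub-rename-fusion eq (var x)   = eq x
  sub-rename-fusion eq (fun f)   = refl
  sub-rename-fusion eq (lam t u) =
    cong₂ lam (sub-rename-fusion eq t) (sub-rename-fusion (exts-ext-fusion eq) u)
  sub-rename-fusion eq (app t u) = cong₂ app (sub-rename-fusion eq t) (sub-rename-fusion eq u)
  sub-rename-fusion eq (pi t u)  =
    cong₂ pi (sub-rename-fusion eq t) (sub-rename-fusion (exts-ext-fusion eq) u)

  ext-exts-fusion : (∀ x → rename ρ (σ x) ≡ σ′ x) →
                    ∀ x → rename (ext {F = F} ρ) (exts σ x) ≡ exts σ′ x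
  ext-exts-fusion eq zero    = refl
  ext-exts-fusion {ρ = ρ} {σ = σ} {σ′ = σ′} eq (suc x) = begin
    rename (ext {F = F} ρ) (rename suc (σ x))  ≡⟨ rename-fusion (λ _ → refl) (σ x) ⟩
    rename (suc ∘ ρ) (σ x)                     ≡⟨ rename-fusion (λ _ → refl) (σ x) ⟨
    rename suc (rename ρ (σ x))                ≡⟨ cong (rename suc) (eq x) ⟩
    rename suc (σ′ x)                          ∎
    where open ≡-Reasoning

  rename-sub-fusion : (∀ x → rename ρ (σ x) ≡ σ′ x) →
                      (t : Term F) → rename ρ (sub σ t) ≡ sub σ′ t
  rename-sub-fusion eq (sort s)  = refl
  rename-sub-fusion eq (var x)   = eq x
  rename-sub-fusion eq (fun f)   = refl
  rename-sub-fusion eq (lam t u) =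
    cong₂ lam (rename-sub-fusion eq t) (rename-sub-fusion (ext-exts-fusion eq) u)
  rename-sub-fusion eq (app t u) = cong₂ app (rename-sub-fusion eq t) (rename-sub-fusion eq u)
  rename-sub-fusion eq (pi t u)  =
    cong₂ pi (rename-sub-fusion eq t) (rename-sub-fusion (ext-exts-fusion eq) u)

  exts-fusion : (∀ x → sub τ (σ x) ≡ σ′ x) → ∀ x → sub (exts τ) (exts σ x) ≡ exts σ′ x
  exts-fusion eq zero    = refl
  exts-fusion {τ = τ} {σ = σ} {σ′ = σ′} eq (suc x) = begin
    sub (exts τ) (rename suc (σ x))  ≡⟨ sub-rename-fusion (λ _ → refl) (σ x) ⟩
    sub (rename suc ∘ τ) (σ x)       ≡⟨ rename-sub-fusion (λ _ → refl) (σ x) ⟨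
    rename suc (sub τ (σ x))         ≡⟨ cong (rename suc) (eq x) ⟩
    rename suc (σ′ x)                ∎
    where open ≡-Reasoning

  sub-fusion : (∀ x → sub τ (σ x) ≡ σ′ x) → (t : Term F) → sub τ (sub σ t) ≡ sub σ′ t
  sub-fusion eq (sort s)  = refl
  sub-fusion eq (var x)   = eq x
  sub-fusion eq (fun f)   = refl
  sub-fusion eq (lam t u) = cong₂ lam (sub-fusion eq t) (sub-fusion (exts-fusion eq) u)
  sub-fusion eq (app t u) = cong₂ app (sub-fusion eq t) (sub-fusion eq u)
  sub-fusion eq (pi t u)  = cong₂ pi (sub-fusion eq t) (sub-fusion (exts-fusion eq) u)

  exts-cong : (∀ x → P (suc x) → σ x ≡ σ′ x) → ∀ x → P x → exts σ x ≡ exts σ′ x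
  exts-cong eq zero    _ = refl
  exts-cong eq (suc x) p = cong (rename suc) (eq x p)

  sub-cong : (t : Term F) → (∀ x → x ∈FV t → σ x ≡ σ′ x) → sub σ t ≡ sub σ′ t
  sub-cong (sort s)  eq = refl
  sub-cong (var x)   eq = eq x (fv-var x)
  sub-cong (fun f)   eq = refl
  sub-cong (lam t u) eq = cong₂ lam (sub-cong t (λ x → eq x ∘ fv-lamˡ))
                                    (sub-cong u (exts-cong (λ x → eq x ∘ fv-lamʳ)))
  sub-cong (app t u) eq = cong₂ app (sub-cong t (λ x → eq x ∘ fv-appˡ))
                                    (sub-cong u (λ x → eq x ∘ fv-appʳ))
  sub-cong (pi t u)  eq = cong₂ pi (sub-cong t (λ x → eq x ∘ fv-piˡ))
                                   (sub-cong u (exts-cong (λ x → eq x ∘ fv-piʳ)))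

  data Headed : Term F → Set where
    fun : ∀ f → Headed (fun f)
    app : Headed t → Headed (app t u)

  headed-apps : ∀ {n} (ts : Vec (Term F) n) → Headed h → Headed (apps h ts)
  headed-apps []       hd = hd
  headed-apps (t ∷ ts) hd = headed-apps ts (app hd)

  headedBySymbol⇒headed : HeadedBySymbol t → Headed t
  headedBySymbol⇒headed (f , _ , ts , refl) = headed-apps ts (fun f)

  headed-¬βRoot : Headed a → ¬ βRoot a b
  headed-¬βRoot (app ()) (beta U v u)

  -- Algebraic terms with the arity constraint forgotten.
  data Spine : Term F → Set
  data FirstOrder : Term F → Set

  data Spine where
    fun : ∀ f → Spine (fun f)
    app : Spine t → FirstOrder u → Spine (app t u)

  data FirstOrder where
    var   : ∀ x → FirstOrder (var x)
    spine : Spine t → FirstOrder t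

  spine-apps : ∀ {n} {ts : Vec (Term F) n} → Spine h → All FirstOrder ts → Spine (apps h ts)
  spine-apps sp []         = sp
  spine-apps sp (fo ∷ fos) = spine-apps (app sp fo) fos

  sub-spine-headed : Spine t → Headed (sub σ t)
  sub-spine-headed (fun f)    = fun f
  sub-spine-headed (app sp _) = app (sub-spine-headed sp)

  module _ {α : F → ℕ} where

    algebraic⇒firstOrder : Algebraic α t → FirstOrder t
    algebraic⇒firstOrders : ∀ {n} {ts : Vec (Term F) n} → All (Algebraic α) ts → All FirstOrder ts

    algebraic⇒firstOrder (alg-var x)      = var x
    algebraic⇒firstOrder (alg-fun f _ as) = spine (spine-apps (fun f) (algebraic⇒firstOrders as))

    algebraic⇒firstOrders []       = []
    algebraic⇒firstOrders (a ∷ as) = algebraic⇒firstOrder a ∷ algebraic⇒firstOrders as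

    algebraic-headed⇒spine : Algebraic α t → Headed t → Spine t
    algebraic-headed⇒spine (alg-var x)      ()
    algebraic-headed⇒spine (alg-fun f _ as) _ = spine-apps (fun f) (algebraic⇒firstOrders as)

  _[_≔_] : (ℕ → Term F) → ℕ → Term F → ℕ → Term F
  (σ [ x ≔ c ]) y with x ≟ y
  ... | yes _ = c
  ... | no _  = σ y

  ≔-same : (σ [ x ≔ c ]) x ≡ c
  ≔-same {x = x} rewrite ≟-diag (refl {x = x}) = refl

  ≔-other : ∀ {y} → x ≢ y → (σ [ x ≔ c ]) y ≡ σ y
  ≔-other {x = x} {y = y} x≢y with x ≟ y
  ... | yes x≡y = ⊥-elim (x≢y x≡y)
  ... | no _    = refl

  sub-≔-fresh : ¬ x ∈FV t → sub (σ [ x ≔ c ]) t ≡ sub σ t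
  sub-≔-fresh {x = x} {t = t} x∉t =
    sub-cong t (λ y y∈t → ≔-other {x = x} λ { refl → x∉t y∈t })

  ∈FV⇒occ : x ∈FV t → 1 ≤ occ x t
  ∈FV⇒occ (fv-var x) rewrite ≟-diag (refl {x = x}) = s≤s z≤n
  ∈FV⇒occ {x} (fv-lamˡ {t = t} {u} p) = ≤-trans (∈FV⇒occ p) (m≤m+n (occ x t) (occ (suc x) u))
  ∈FV⇒occ {x} (fv-lamʳ {t = t} {u} p) = ≤-trans (∈FV⇒occ p) (m≤n+m (occ (suc x) u) (occ x t))
  ∈FV⇒occ {x} (fv-appˡ {t = t} {u} p) = ≤-trans (∈FV⇒occ p) (m≤m+n (occ x t) (occ x u))
  ∈FV⇒occ {x} (fv-appʳ {t = t} {u} p) = ≤-trans (∈FV⇒occ p) (m≤n+m (occ x u) (occ x t))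
  ∈FV⇒occ {x} (fv-piˡ {t = t} {u} p)  = ≤-trans (∈FV⇒occ p) (m≤m+n (occ x t) (occ (suc x) u))
  ∈FV⇒occ {x} (fv-piʳ {t = t} {u} p)  = ≤-trans (∈FV⇒occ p) (m≤n+m (occ (suc x) u) (occ x t))

  record LinearTerm (t : Term F) : Set where
    constructor linear
    field occ≤1 : ∀ x → occ x t ≤ 1

  linear-appˡ : LinearTerm (app t u) → LinearTerm t
  linear-appˡ {t} {u} (linear occ≤1) = linear λ x → ≤-trans (m≤m+n (occ x t) (occ x u)) (occ≤1 x)

  linear-appʳ : LinearTerm (app t u) → LinearTerm u
  linear-appʳ {t} {u} (linear occ≤1) = linear λ x → ≤-trans (m≤n+m (occ x u) (occ x t)) (occ≤1 x)

  linear-app-disjoint : LinearTerm (app t u) → x ∈FV t → ¬ x ∈FV u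
  linear-app-disjoint {x = x} (linear occ≤1) x∈t x∈u =
    1+n≰n (≤-trans (+-mono-≤ (∈FV⇒occ x∈t) (∈FV⇒occ x∈u)) (occ≤1 x))

  data StepInSubst (σ : ℕ → Term F) (t : Term F) : Term F → Set where
    inside : x ∈FV t → σ x ⟶β c → StepInSubst σ t (sub (σ [ x ≔ c ]) t)

  stepInSubst-appˡ : LinearTerm (app t u) → StepInSubst σ t b →
                     StepInSubst σ (app t u) (app b (sub σ u))
  stepInSubst-appˡ {σ = σ} lin (inside {x} {c} x∈t st) =
    subst (StepInSubst σ _ ∘ app _) (sub-≔-fresh {σ = σ} {c = c} (linear-app-disjoint lin x∈t))
          (inside (fv-appˡ x∈t) st)

  stepInSubst-appʳ : LinearTerm (app t u) → StepInSubst σ u b →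
                     StepInSubst σ (app t u) (app (sub σ t) b)
  stepInSubst-appʳ {σ = σ} lin (inside {x} {c} x∈u st) =
    subst (λ t′ → StepInSubst σ _ (app t′ _))
          (sub-≔-fresh {σ = σ} {c = c} λ x∈t → linear-app-disjoint lin x∈t x∈u)
          (inside (fv-appʳ x∈u) st)

  spine-sub-⟶β-inv : Spine t → LinearTerm t → sub σ t ⟶β b → StepInSubst σ t b
  firstOrder-sub-⟶β-inv : FirstOrder t → LinearTerm t → sub σ t ⟶β b → StepInSubst σ t b

  spine-sub-⟶β-inv (fun f) lin (root ())
  spine-sub-⟶β-inv sp@(app _ _) lin (root r) = ⊥-elim (headed-¬βRoot (sub-spine-headed sp) r)
  spine-sub-⟶β-inv (app sp fo) lin (appˡ st) =
    stepInSubst-appˡ lin (spine-sub-⟶β-inv sp (linear-appˡ lin) st)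
  spine-sub-⟶β-inv (app sp fo) lin (appʳ st) =
    stepInSubst-appʳ lin (firstOrder-sub-⟶β-inv fo (linear-appʳ lin) st)

  firstOrder-sub-⟶β-inv {σ = σ} (var x) lin st =
    subst (StepInSubst σ (var x)) (≔-same {σ = σ} {x = x}) (inside (fv-var x) st)
  firstOrder-sub-⟶β-inv (spine sp) lin st = spine-sub-⟶β-inv sp lin st

  spine-sub-⟶β : Spine t → LinearTerm t → x ∈FV t → σ x ⟶β c →
                 sub σ t ⟶β sub (σ [ x ≔ c ]) t
  firstOrder-sub-⟶β : FirstOrder t → LinearTerm t → x ∈FV t → σ x ⟶β c →
                       sub σ t ⟶β sub (σ [ x ≔ c ]) t

  spine-sub-⟶β (fun f) lin () st
  spine-sub-⟶β {σ = σ} {c = c} (app sp fo) lin (fv-appˡ x∈t) st =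
    subst (λ u′ → _ ⟶β app _ u′)
          (sym (sub-≔-fresh {σ = σ} {c = c} (linear-app-disjoint lin x∈t)))
          (appˡ (spine-sub-⟶β sp (linear-appˡ lin) x∈t st))
  spine-sub-⟶β {σ = σ} {c = c} (app sp fo) lin (fv-appʳ x∈u) st =
    subst (λ t′ → _ ⟶β app t′ _)
          (sym (sub-≔-fresh {σ = σ} {c = c} λ x∈t → linear-app-disjoint lin x∈t x∈u))
          (appʳ (firstOrder-sub-⟶β fo (linear-appʳ lin) x∈u st))

  firstOrder-sub-⟶β {σ = σ} (var x) lin (fv-var x) st = subst (σ x ⟶β_) (sym (≔-same {x = x})) st
  firstOrder-sub-⟶β (spine sp) lin x∈t st = spine-sub-⟶β sp lin x∈t st

  Compat-sub : (∀ σ {a b} → R a b → R (sub σ a) (sub σ b)) →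
               ∀ σ → Compat R a b → Compat R (sub σ a) (sub σ b)
  Compat-sub R-sub σ (root r) = root (R-sub σ r)
  Compat-sub R-sub σ (lamˡ p) = lamˡ (Compat-sub R-sub σ p)
  Compat-sub R-sub σ (lamʳ p) = lamʳ (Compat-sub R-sub (exts σ) p)
  Compat-sub R-sub σ (appˡ p) = appˡ (Compat-sub R-sub σ p)
  Compat-sub R-sub σ (appʳ p) = appʳ (Compat-sub R-sub σ p)
  Compat-sub R-sub σ (piˡ p)  = piˡ (Compat-sub R-sub σ p)
  Compat-sub R-sub σ (piʳ p)  = piʳ (Compat-sub R-sub (exts σ) p)

  Compat-rename : (∀ ρ {a b} → R a b → R (rename ρ a) (rename ρ b)) →
                  ∀ ρ → Compat R a b → Compat R (rename ρ a) (rename ρ b)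
  Compat-rename R-ren ρ (root r) = root (R-ren ρ r)
  Compat-rename R-ren ρ (lamˡ p) = lamˡ (Compat-rename R-ren ρ p)
  Compat-rename R-ren ρ (lamʳ p) = lamʳ (Compat-rename R-ren (ext {F = F} ρ) p)
  Compat-rename R-ren ρ (appˡ p) = appˡ (Compat-rename R-ren ρ p)
  Compat-rename R-ren ρ (appʳ p) = appʳ (Compat-rename R-ren ρ p)
  Compat-rename R-ren ρ (piˡ p)  = piˡ (Compat-rename R-ren ρ p)
  Compat-rename R-ren ρ (piʳ p)  = piʳ (Compat-rename R-ren (ext {F = F} ρ) p)

  sub₀ : Term F → ℕ → Term F
  sub₀ u zero    = u
  sub₀ u (suc x) = var x

  []≡sub₀ : ∀ v → v [ u ] ≡ sub (sub₀ u) v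
  []≡sub₀ v = sub-cong v λ { zero _ → refl ; (suc x) _ → refl }

  module _ {E : Term F → Term F → Set} where

    private
      infix 4 _⟶ₑ_ _∼_
      _⟶ₑ_ _∼_ : Term F → Term F → Set
      _⟶ₑ_ = E ⟶E_
      a ∼ b = a ∼[ E ] b

    ERoot-sub : ∀ τ {a b} → ERoot E a b → ERoot E (sub τ a) (sub τ b)
    ERoot-sub τ (inst {l} {r} e σ) =
      subst₂ (ERoot E) (sym (sub-fusion (λ _ → refl) l)) (sym (sub-fusion (λ _ → refl) r))
             (inst e (sub τ ∘ σ))

    ERoot-rename : ∀ ρ {a b} → ERoot E a b → ERoot E (rename ρ a) (rename ρ b)
    ERoot-rename ρ (inst {l} {r} e σ) =
      subst₂ (ERoot E) (sym (rename-sub-fusion (λ _ → refl) l))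
                       (sym (rename-sub-fusion (λ _ → refl) r))
             (inst e (rename ρ ∘ σ))

    ∼-cong₂ : (C : Term F → Term F → Term F) →
              (∀ {a a′ b} → a ⟶ₑ a′ → C a b ⟶ₑ C a′ b) →
              (∀ {a b b′} → b ⟶ₑ b′ → C a b ⟶ₑ C a b′) →
              a ∼ a′ → b ∼ b′ → C a b ∼ C a′ b′
    ∼-cong₂ C congˡ congʳ p q = gmap (λ a → C a _) congˡ p ◅◅ gmap (C _) congʳ q

    ∼-exts : (∀ x → σ x ∼ σ′ x) → ∀ x → exts σ x ∼ exts σ′ x
    ∼-exts eq zero    = ε
    ∼-exts eq (suc x) = gmap (rename suc) (Compat-rename ERoot-rename suc) (eq x)

    ∼-sub-cong : (∀ x → σ x ∼ σ′ x) → (t : Term F) → sub σ t ∼ sub σ′ t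
    ∼-sub-cong eq (sort s)  = ε
    ∼-sub-cong eq (var x)   = eq x
    ∼-sub-cong eq (fun f)   = ε
    ∼-sub-cong eq (lam t u) = ∼-cong₂ lam lamˡ lamʳ (∼-sub-cong eq t) (∼-sub-cong (∼-exts eq) u)
    ∼-sub-cong eq (app t u) = ∼-cong₂ app appˡ appʳ (∼-sub-cong eq t) (∼-sub-cong eq u)
    ∼-sub-cong eq (pi t u)  = ∼-cong₂ pi piˡ piʳ (∼-sub-cong eq t) (∼-sub-cong (∼-exts eq) u)

    ⟶ₑ-[]-congˡ : v ⟶ₑ v′ → v [ u ] ⟶ₑ v′ [ u ]
    ⟶ₑ-[]-congˡ {v} {v′} {u} p =
      subst₂ _⟶ₑ_ (sym ([]≡sub₀ v)) (sym ([]≡sub₀ v′)) (Compat-sub ERoot-sub (sub₀ u) p)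

    ∼-[]-congʳ : ∀ v → u ∼ u′ → v [ u ] ∼ v [ u′ ]
    ∼-[]-congʳ v p =
      subst₂ _∼_ (sym ([]≡sub₀ v)) (sym ([]≡sub₀ v))
                 (∼-sub-cong (λ { zero → p ; (suc x) → ε }) v)

    under : (C : Term F → Term F) → (∀ {R a b} → Compat R a b → Compat R (C a) (C b)) →
            (_⟶β_ ; _∼_) a b → (_⟶β_ ; _∼_) (C a) (C b)
    under C congC (b′ , st , q) = C b′ , congC st , gmap C congC q

    module _ {α : F → ℕ} (isE : IsEquations α E) (lin : Linear E) where

      open IsEquations isE

      rhs-spine : ∀ {l r} → E l r → Spine r
      rhs-spine {l} {r} e = algebraic-headed⇒spine (alg-r l r e) (headedBySymbol⇒headed (head-r l r e))

      ERoot-headed : ERoot E a b → Headed b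
      ERoot-headed (inst e σ) = sub-spine-headed (rhs-spine e)

      ERoot-postpone : ERoot E a a′ → a′ ⟶β b → (_⟶β_ ; _∼_) a b
      ERoot-postpone (inst {l} {r} e σ) st
        with firstOrder-sub-⟶β-inv (spine (rhs-spine e)) (linear (proj₂ ∘ lin l r e)) st
      ... | inside {x} {c} x∈r σx⟶c =
        sub (σ [ x ≔ c ]) l ,
        firstOrder-sub-⟶β (algebraic⇒firstOrder (alg-l l r e)) (linear (proj₁ ∘ lin l r e))
                          (Equivalence.from (fv-eq l r e x) x∈r) σx⟶c ,
        return (root (inst e (σ [ x ≔ c ])))

      ⟶ₑ-postpone : a ⟶ₑ a′ → a′ ⟶β b → (_⟶β_ ; _∼_) a b
      ⟶ₑ-postpone (root r)  st        = ERoot-postpone r st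
      ⟶ₑ-postpone (lamˡ _)  (root ())
      ⟶ₑ-postpone (lamʳ _)  (root ())
      ⟶ₑ-postpone (lamˡ e)  (lamˡ st) = under (λ t → lam t _) lamˡ (⟶ₑ-postpone e st)
      ⟶ₑ-postpone (lamʳ e)  (lamʳ st) = under (lam _) lamʳ (⟶ₑ-postpone e st)
      ⟶ₑ-postpone (lamˡ e)  (lamʳ st) = _ , lamʳ st , return (lamˡ e)
      ⟶ₑ-postpone (lamʳ e)  (lamˡ st) = _ , lamˡ st , return (lamʳ e)
      ⟶ₑ-postpone (piˡ _)   (root ())
      ⟶ₑ-postpone (piʳ _)   (root ())
      ⟶ₑ-postpone (piˡ e)   (piˡ st)  = under (λ t → pi t _) piˡ (⟶ₑ-postpone e st)
      ⟶ₑ-postpone (piʳ e)   (piʳ st)  = under (pi _) piʳ (⟶ₑ-postpone e st)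
      ⟶ₑ-postpone (piˡ e)   (piʳ st)  = _ , piʳ st , return (piˡ e)
      ⟶ₑ-postpone (piʳ e)   (piˡ st)  = _ , piˡ st , return (piʳ e)
      ⟶ₑ-postpone (appˡ e)  (appˡ st) = under (λ t → app t _) appˡ (⟶ₑ-postpone e st)
      ⟶ₑ-postpone (appʳ e)  (appʳ st) = under (app _) appʳ (⟶ₑ-postpone e st)
      ⟶ₑ-postpone (appˡ e)  (appʳ st) = _ , appʳ st , return (appˡ e)
      ⟶ₑ-postpone (appʳ e)  (appˡ st) = _ , appˡ st , return (appʳ e)
      ⟶ₑ-postpone (appˡ (root r)) (root (beta U v u)) with () ← ERoot-headed r
      ⟶ₑ-postpone (appˡ (lamˡ e)) (root (beta U v u)) = _ , root (beta _ v u) , ε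
      ⟶ₑ-postpone (appˡ (lamʳ e)) (root (beta U v u)) =
        _ , root (beta U _ u) , return (⟶ₑ-[]-congˡ e)
      ⟶ₑ-postpone (appʳ e)        (root (beta U v u)) =
        _ , root (beta U v _) , ∼-[]-congʳ v (return e)

      ∼-postpone : (_∼_ ; _⟶β_) ⇒ (_⟶β_ ; _∼_)
      ∼-postpone (_ , ε , st) = _ , st , ε
      ∼-postpone (_ , e ◅ es , st) =
        let _ , st₁ , q₁ = ∼-postpone (_ , es , st)
            b , st₂ , q₂ = ⟶ₑ-postpone e st₁
        in  b , st₂ , q₂ ◅◅ q₁

  SN-postpone : (Star Q ; R) ⇒ (R ; Star Q) → SN R t → SN (Star Q ; R) t
  SN-postpone {Q = Q} {R = R} postpone snR (s , s₀≡t , s-steps) = snR (s′ , s₀≡t , s′-steps)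
    where
    shadow : ∀ n → ∃ λ v → Star Q v (s n)
    next : ∀ n → (R ; Star Q) (proj₁ (shadow n)) (s (suc n))

    shadow zero    = s 0 , ε
    shadow (suc n) = let v , _ , q = next n in v , q

    next n = let _ , q = shadow n ; a , q′ , st = s-steps n in postpone (a , q ◅◅ q′ , st)

    s′ : ℕ → Term F
    s′ = proj₁ ∘ shadow

    s′-steps : ∀ n → R (s′ n) (s′ (suc n))
    s′-steps n = proj₁ (proj₂ (next n))

corollary1 : (F : Set) (α : F → ℕ) (E : Term F → Term F → Set) →
             IsEquations α E → Linear E →
             (t : Term F) → SN _⟶β_ t → SN (λ a b → a ∼⟶β[ E ] b) t
corollary1 F α E isE lin t = SN-postpone (∼-postpone isE lin)
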